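{- Let $S$ be a string, $f$ an involution on its alphabet, $j$ a position in $S$, and $\Delta,k,i$ integers with $k\ge 2$. If $P_{j,\Delta}=\{i,i+\Delta,\ldots,i+(k-1)\Delta\}$ (i.e., $(i,\Delta,k)\in G_j$), then $P_{j-\Delta,\Delta}=\{i,i+\Delta,\ldots,i+(k-2)\Delta\}$ (i.e., $(i,\Delta,k-1)\in G_{j-\Delta}$).
   Context: An involution $f$ satisfies $f\circ f=\mathrm{id}$ and is extended letterwise to strings; a string $x$ is a generalized palindrome if $x=f(x^R)$, where $x^R$ is the reverse of $x$. Strings are indexed from 1 and $S[a..b]=S[a]\cdots S[b]$. For a position $j$, $P_j$ is the increasingly sorted list of all $a\in[1..j]$ such that $S[a..j]$ is a generalized palindrome. For $\Delta$, $P_{j,\Delta}$ is the sublist of $P_j$ consisting of the elements whose predecessor in $P_j$ is smaller by exactly $\Delta$ (the first element of $P_j$ is assigned $\Delta=\infty$). $G_j$ is the set of triples $(i,\Delta,k)$ with $P_{j,\Delta}=\{i,i+\Delta,\ldots,i+(k-1)\Delta\}$ nonempty. -}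

module Defs where

open import Data.Nat using (ℕ; _+_; _*_; _∸_; _≤_; _<_)
open import Data.List using (List; take; drop; reverse; map)
open import Data.Product using (Σ; _×_)
open import Relation.Nullary using (¬_)
open import Relation.Binary.PropositionalEquality using (_≡_)

IsInvolution : {A : Set} → (A → A) → Set
IsInvolution {A} f = ∀ (x : A) → f (f x) ≡ x

GenPal : {A : Set} → (A → A) → List A → Set
GenPal f x = x ≡ map f (reverse x)

-- S[a..b] with 1-based indexing (used only for 1 ≤ a ≤ b ≤ |S|)
sub : {A : Set} → List A → ℕ → ℕ → List A
sub S a b = take (suc' (b ∸ a)) (drop (a ∸ 1) S)
  where suc' : ℕ → ℕ
        suc' n = n + 1

InP : {A : Set} → (A → A) → List A → ℕ → ℕ → Set
InP f S j a = (1 ≤ a) × (a ≤ j) × GenPal f (sub S a j)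

IsPred : {A : Set} → (A → A) → List A → ℕ → ℕ → ℕ → Set
IsPred f S j p a =
  InP f S j p × InP f S j a × (p < a) ×
  (∀ b → p < b → b < a → ¬ InP f S j b)

-- a ∈ P_{j,Δ} : a ∈ P_j and its predecessor in P_j is a − Δ
-- (the first element of P_j, with Δ = ∞, never belongs to P_{j,Δ} for Δ ∈ ℕ)
InPΔ : {A : Set} → (A → A) → List A → ℕ → ℕ → ℕ → Set
InPΔ f S j Δ a = Σ ℕ (λ p → IsPred f S j p a × (p + Δ ≡ a))

InProg : ℕ → ℕ → ℕ → ℕ → Set
InProg i Δ k a = Σ ℕ (λ t → (t < k) × (a ≡ i + t * Δ))

_≐_ : (ℕ → Set) → (ℕ → Set) → Set
P ≐ Q = ∀ a → (P a → Q a) × (Q a → P a)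

-- Two generalized palindromes S[p..J] and S[p+Δ..J] with a common end force period Δ on
-- S[p..J], and inside a Δ-periodic stretch a generalized palindrome may be shifted by Δ and
-- shrunk or grown by Δ at its right end. Take J = j + Δ. If a and a + Δ both lie in P_{J,Δ},
-- the period on S[a−Δ..J] moves a − Δ and a into P_j and would move any element of P_j
-- between them to an element of P_J between a and a + Δ. Conversely, the period Δ of
-- S[i−Δ..J] extends that of S[b−Δ..j] for every b ∈ P_{j,Δ}, which puts b and b + Δ into
-- P_{J,Δ}. So P_{j,Δ} is P_{J,Δ} without its largest element.
module Submission where

open import Defs
open import Data.Nat using (ℕ; zero; suc; _+_; _*_; _∸_; _≤_; _<_; _≤?_; z≤n; s≤s; z<s; s<s; s<s⁻¹; >-nonZero)
open import Data.Nat.Properties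
open import Data.Nat.Tactic.RingSolver using (solve)
open import Algebra.Properties.CommutativeSemigroup +-commutativeSemigroup using (xy∙z≈xz∙y)
open import Data.List using (List; []; _∷_; _++_; [_]; length; map; reverse; take; drop)
open import Data.List.Properties using (length-map; length-reverse; length-take; unfold-reverse)
open import Data.Maybe using (Maybe; just; nothing)
import Data.Maybe as Maybe
open import Data.Product using (_×_; _,_; proj₁; proj₂)
open import Data.Sum using (_⊎_; inj₁; inj₂)
open import Function using (_∘_)
open import Function.Bundles using (_⇔_; mk⇔; Equivalence)
open import Relation.Nullary using (¬_; yes; no)
open import Relation.Binary.PropositionalEquality hiding ([_])

mirrored-offsets-≥ : ∀ {a b d m n} → a + d ≤ b → a + m + n ≡ b + d → d ≤ m ⊎ d ≤ n
mirrored-offsets-≥ {a} {b} {d} {m} {n} a+d≤b eq with d ≤? m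
... | yes d≤m = inj₁ d≤m
... | no d≰m  = inj₂ (<⇒≤ (+-cancelˡ-< d d n (≤-<-trans d+d≤m+n (+-monoˡ-< n (≰⇒> d≰m)))))
  where
  open ≤-Reasoning
  d+d≤m+n : d + d ≤ m + n
  d+d≤m+n = +-cancelˡ-≤ a (d + d) (m + n) (begin
    a + (d + d)  ≡⟨ sym (+-assoc a d d) ⟩
    a + d + d    ≤⟨ +-monoˡ-≤ d a+d≤b ⟩
    b + d        ≡⟨ sym eq ⟩
    a + m + n    ≡⟨ +-assoc a m n ⟩
    a + (m + n)  ∎)

module Reflections {B : Set} (g : B → B) (g-inv : IsInvolution g) (w : ℕ → B) where

  -- Mirror positions in w[a..b] are written a + m and a + n with a + m + n = b.
  IsPal : ℕ → ℕ → Set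
  IsPal a b = ∀ m n → a + m + n ≡ b → w (a + m) ≡ g (w (a + n))

  Periodic : ℕ → ℕ → ℕ → Set
  Periodic d a b = ∀ x → a ≤ x → x + d ≤ b → w x ≡ w (x + d)

  g-flip : ∀ {u v} → u ≡ g v → v ≡ g u
  g-flip {u} {v} u≡gv = trans (sym (g-inv v)) (cong g (sym u≡gv))

  periodic-at : ∀ {d a b} → Periodic d a b → ∀ {m n} → a + m + d + n ≡ b → w (a + m) ≡ w (a + m + d)
  periodic-at {d} {a} per {m} {n} refl = per (a + m) (m≤m+n a m) (m≤m+n (a + m + d) n)

  periodic-mono : ∀ {d a a′ b} → Periodic d a b → a ≤ a′ → Periodic d a′ b
  periodic-mono per a≤a′ x a′≤x = per x (≤-trans a≤a′ a′≤x)

  periodic-glue : ∀ {d a a′ b c} → Periodic d a b → Periodic d a′ c → a′ + d ≤ b → Periodic d a c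
  periodic-glue {d} {a′ = a′} {b} per per′ a′+d≤b x a≤x x+d≤c with x + d ≤? b
  ... | yes x+d≤b = per x a≤x x+d≤b
  ... | no x+d≰b  = per′ x (+-cancelʳ-≤ d a′ x (≤-trans a′+d≤b (<⇒≤ (≰⇒> x+d≰b)))) x+d≤c

  pals⇒periodic : ∀ {d a b} → IsPal a b → IsPal (a + d) b → Periodic d a b
  pals⇒periodic {d} {a} pal pal′ x a≤x x+d≤b with m≤n⇒∃[o]m+o≡n a≤x
  ... | m , refl with m≤n⇒∃[o]m+o≡n x+d≤b
  ... | n , refl = begin
    w (a + m)              ≡⟨ pal m (d + n) (sym (+-assoc (a + m) d n)) ⟩
    g (w (a + (d + n)))    ≡⟨ cong (g ∘ w) (sym (+-assoc a d n)) ⟩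
    g (w (a + d + n))      ≡⟨ cong g (pal′ n m shifted) ⟩
    g (g (w (a + d + m)))  ≡⟨ g-inv _ ⟩
    w (a + d + m)          ≡⟨ cong w (xy∙z≈xz∙y a d m) ⟩
    w (a + m + d)          ∎
    where
    open ≡-Reasoning
    shifted : a + d + n + m ≡ a + m + d + n
    shifted = solve (a ∷ d ∷ n ∷ m ∷ [])

  pal-dropˡ : ∀ {d a b} → IsPal a b → Periodic d a b → IsPal (a + d) b
  pal-dropˡ {d} {a} pal per m n refl = begin
    w (a + d + m)          ≡⟨ cong w (xy∙z≈xz∙y a d m) ⟩
    w (a + m + d)          ≡⟨ sym (periodic-at per m-side) ⟩
    w (a + m)              ≡⟨ pal m (d + n) unshifted ⟩
    g (w (a + (d + n)))    ≡⟨ cong (g ∘ w) (sym (+-assoc a d n)) ⟩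
    g (w (a + d + n))      ∎
    where
    open ≡-Reasoning
    m-side : a + m + d + n ≡ a + d + m + n
    m-side = solve (a ∷ m ∷ d ∷ n ∷ [])
    unshifted : a + m + (d + n) ≡ a + d + m + n
    unshifted = solve (a ∷ m ∷ d ∷ n ∷ [])

  pal-shift : ∀ {d a b} → IsPal a b → Periodic d a (b + d) → IsPal (a + d) (b + d)
  pal-shift {d} {a} {b} pal per m n eq = begin
    w (a + d + m)          ≡⟨ cong w (xy∙z≈xz∙y a d m) ⟩
    w (a + m + d)          ≡⟨ sym (periodic-at per m-side) ⟩
    w (a + m)              ≡⟨ pal m n unshifted ⟩
    g (w (a + n))          ≡⟨ cong g (periodic-at per n-side) ⟩
    g (w (a + n + d))      ≡⟨ cong (g ∘ w) (xy∙z≈xz∙y a n d) ⟩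
    g (w (a + d + n))      ∎
    where
    open ≡-Reasoning
    m-side : a + m + d + n ≡ b + d
    m-side = begin a + m + d + n ≡⟨ solve (a ∷ m ∷ d ∷ n ∷ []) ⟩ a + d + m + n ≡⟨ eq ⟩ b + d ∎
    unshifted : a + m + n ≡ b
    unshifted = +-cancelʳ-≡ d _ _
      (begin a + m + n + d ≡⟨ solve (a ∷ m ∷ n ∷ d ∷ []) ⟩ a + d + m + n ≡⟨ eq ⟩ b + d ∎)
    n-side : a + n + d + m ≡ b + d
    n-side = begin
      a + n + d + m ≡⟨ solve (a ∷ n ∷ d ∷ m ∷ []) ⟩ a + m + n + d ≡⟨ cong (_+ d) unshifted ⟩ b + d ∎

  pal-unshift : ∀ {d a b} → IsPal (a + d) (b + d) → Periodic d a (b + d) → IsPal a b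
  pal-unshift {d} {a} pal per m n refl = begin
    w (a + m)              ≡⟨ periodic-at per m-side ⟩
    w (a + m + d)          ≡⟨ cong w (xy∙z≈xz∙y a m d) ⟩
    w (a + d + m)          ≡⟨ pal m n shifted ⟩
    g (w (a + d + n))      ≡⟨ cong (g ∘ w) (xy∙z≈xz∙y a d n) ⟩
    g (w (a + n + d))      ≡⟨ cong g (sym (periodic-at per n-side)) ⟩
    g (w (a + n))          ∎
    where
    open ≡-Reasoning
    m-side : a + m + d + n ≡ a + m + n + d
    m-side = solve (a ∷ m ∷ d ∷ n ∷ [])
    shifted : a + d + m + n ≡ a + m + n + d
    shifted = solve (a ∷ d ∷ m ∷ n ∷ [])
    n-side : a + n + d + m ≡ a + m + n + d
    n-side = solve (a ∷ n ∷ d ∷ m ∷ [])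

  pal-dropʳ : ∀ {d a b} → IsPal a (b + d) → Periodic d a (b + d) → IsPal a b
  pal-dropʳ pal per = pal-unshift (pal-dropˡ pal per) per

  reflect-beyond-period : ∀ {d a b m n} → IsPal a b → Periodic d a (b + d) →
                          a + m + n ≡ b + d → d ≤ m → w (a + m) ≡ g (w (a + n))
  reflect-beyond-period {d} {a} {b} {n = n} pal per eq d≤m with m≤n⇒∃[o]m+o≡n d≤m
  ... | m , refl = begin
    w (a + (d + m))        ≡⟨ cong w (trans (sym (+-assoc a d m)) (xy∙z≈xz∙y a d m)) ⟩
    w (a + m + d)          ≡⟨ sym (periodic-at per m-side) ⟩
    w (a + m)              ≡⟨ pal m n unshifted ⟩
    g (w (a + n))          ∎
    where
    open ≡-Reasoning
    m-side : a + m + d + n ≡ b + d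
    m-side = begin a + m + d + n ≡⟨ solve (a ∷ m ∷ d ∷ n ∷ []) ⟩ a + (d + m) + n ≡⟨ eq ⟩ b + d ∎
    unshifted : a + m + n ≡ b
    unshifted = +-cancelʳ-≡ d _ _
      (begin a + m + n + d ≡⟨ solve (a ∷ m ∷ n ∷ d ∷ []) ⟩ a + (d + m) + n ≡⟨ eq ⟩ b + d ∎)

  pal-extendʳ : ∀ {d a b} → IsPal a b → Periodic d a (b + d) → a + d ≤ b → IsPal a (b + d)
  pal-extendʳ {a = a} pal per a+d≤b m n eq with mirrored-offsets-≥ a+d≤b eq
  ... | inj₁ d≤m = reflect-beyond-period pal per eq d≤m
  ... | inj₂ d≤n = g-flip (reflect-beyond-period pal per (trans (xy∙z≈xz∙y a n m) eq) d≤n)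

private
  variable
    A B : Set

at : List A → ℕ → Maybe A
at []       _       = nothing
at (x ∷ xs) zero    = just x
at (x ∷ xs) (suc m) = at xs m

at-map : ∀ (f : A → B) xs m → at (map f xs) m ≡ Maybe.map f (at xs m)
at-map f []       m       = refl
at-map f (x ∷ xs) zero    = refl
at-map f (x ∷ xs) (suc m) = at-map f xs m

at-++ˡ : ∀ (xs ys : List A) {m} → m < length xs → at (xs ++ ys) m ≡ at xs m
at-++ˡ (x ∷ xs) ys {zero}  _         = refl
at-++ˡ (x ∷ xs) ys {suc m} (s<s m<n) = at-++ˡ xs ys m<n

at-++-length : ∀ (xs : List A) {y ys} → at (xs ++ y ∷ ys) (length xs) ≡ just y
at-++-length []       = refl
at-++-length (x ∷ xs) = at-++-length xs

at-take : ∀ k (xs : List A) {m} → m < k → at (take k xs) m ≡ at xs m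
at-take (suc k) []       _         = refl
at-take (suc k) (x ∷ xs) {zero}  _         = refl
at-take (suc k) (x ∷ xs) {suc m} (s<s m<k) = at-take k xs m<k

at-drop : ∀ k (xs : List A) m → at (drop k xs) m ≡ at xs (k + m)
at-drop zero    xs       m = refl
at-drop (suc k) []       m = refl
at-drop (suc k) (x ∷ xs) m = at-drop k xs m

at-reverse : ∀ (xs : List A) {m n} → suc (m + n) ≡ length xs → at (reverse xs) m ≡ at xs n
at-reverse (x ∷ xs) {m} {zero} eq = begin
  at (reverse (x ∷ xs)) m     ≡⟨ cong (λ ys → at ys m) (unfold-reverse x xs) ⟩
  at (reverse xs ++ [ x ]) m  ≡⟨ cong (at (reverse xs ++ [ x ])) m≡∣xs∣ ⟩
  at (reverse xs ++ [ x ]) (length (reverse xs))  ≡⟨ at-++-length (reverse xs) ⟩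
  just x                      ∎
  where
  open ≡-Reasoning
  m≡∣xs∣ : m ≡ length (reverse xs)
  m≡∣xs∣ = trans (sym (+-identityʳ m)) (trans (suc-injective eq) (sym (length-reverse xs)))
at-reverse (x ∷ xs) {m} {suc n} eq = begin
  at (reverse (x ∷ xs)) m     ≡⟨ cong (λ ys → at ys m) (unfold-reverse x xs) ⟩
  at (reverse xs ++ [ x ]) m  ≡⟨ at-++ˡ (reverse xs) [ x ] m<∣xs∣ ⟩
  at (reverse xs) m           ≡⟨ at-reverse xs eq′ ⟩
  at xs n                     ∎
  where
  open ≡-Reasoning
  eq′ : suc (m + n) ≡ length xs
  eq′ = trans (sym (+-suc m n)) (suc-injective eq)
  m<∣xs∣ : m < length (reverse xs)
  m<∣xs∣ = subst (m <_) (trans eq′ (sym (length-reverse xs))) (s≤s (m≤m+n m n))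

at-ext : ∀ (xs ys : List A) → length xs ≡ length ys →
         (∀ m → m < length xs → at xs m ≡ at ys m) → xs ≡ ys
at-ext []       []       _   _  = refl
at-ext (x ∷ xs) (y ∷ ys) len pw with pw zero z<s
... | refl = cong (x ∷_) (at-ext xs ys (suc-injective len) (λ m → pw (suc m) ∘ s<s))

Mirrored : (A → A) → List A → Set
Mirrored f xs = ∀ m n → suc (m + n) ≡ length xs → at xs m ≡ Maybe.map f (at xs n)

GenPal⇔mirrored : ∀ (f : A → A) xs → GenPal f xs ⇔ Mirrored f xs
GenPal⇔mirrored f xs = mk⇔ to from
  where
  open ≡-Reasoning
  to : GenPal f xs → Mirrored f xs
  to pal m n eq = begin
    at xs m                          ≡⟨ cong (λ ys → at ys m) pal ⟩
    at (map f (reverse xs)) m        ≡⟨ at-map f (reverse xs) m ⟩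
    Maybe.map f (at (reverse xs) m)  ≡⟨ cong (Maybe.map f) (at-reverse xs eq) ⟩
    Maybe.map f (at xs n)            ∎
  from : Mirrored f xs → GenPal f xs
  from mirrored = at-ext xs (map f (reverse xs))
    (sym (trans (length-map f (reverse xs)) (length-reverse xs)))
    pointwise
    where
    pointwise : ∀ m → m < length xs → at xs m ≡ at (map f (reverse xs)) m
    pointwise m m<∣xs∣ with m≤n⇒∃[o]m+o≡n m<∣xs∣
    ... | n , eq = begin
      at xs m                          ≡⟨ mirrored m n eq ⟩
      Maybe.map f (at xs n)            ≡⟨ cong (Maybe.map f) (sym (at-reverse xs eq)) ⟩
      Maybe.map f (at (reverse xs) m)  ≡⟨ sym (at-map f (reverse xs) m) ⟩
      at (map f (reverse xs)) m        ∎

length-take-drop : ∀ a k (xs : List A) → a + k ≤ length xs → length (take k (drop a xs)) ≡ k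
length-take-drop zero    k xs       k≤∣xs∣   = trans (length-take k xs) (m≤n⇒m⊓n≡m k≤∣xs∣)
length-take-drop (suc a) k (x ∷ xs) (s≤s le) = length-take-drop a k xs le

-- S[x] with 1-based positions; nothing at position 0 and beyond the end
letter : List A → ℕ → Maybe A
letter S zero    = nothing
letter S (suc x) = at S x

maybe-map-involutive : {f : A → A} → IsInvolution f → IsInvolution (Maybe.map f)
maybe-map-involutive f-inv nothing  = refl
maybe-map-involutive f-inv (just x) = cong just (f-inv x)

InProg-start : ∀ {i Δ k} → InProg i Δ (suc k) i
InProg-start {i} = 0 , z<s , sym (+-identityʳ i)

InProg-weaken : ∀ {i Δ k a} → InProg i Δ k a → InProg i Δ (suc k) a
InProg-weaken (t , t<k , a≡) = t , m<n⇒m<1+n t<k , a≡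

InProg-next : ∀ {i Δ k a} → InProg i Δ k a → InProg i Δ (suc k) (a + Δ)
InProg-next {i} {Δ} (t , t<k , refl) = suc t , s<s t<k , next
  where
  next : i + t * Δ + Δ ≡ i + suc t * Δ
  next = solve (i ∷ t ∷ Δ ∷ [])

InProg-prev : ∀ {i Δ k m a} → 0 < Δ → InProg i Δ m a → InProg i Δ (suc k) (a + Δ) → InProg i Δ k a
InProg-prev {i} {Δ} {k} 0<Δ (t , _ , refl) (t′ , t′<1+k , eq) =
  t , s<s⁻¹ (subst (_< suc k) t′≡1+t t′<1+k) , refl
  where
  instance
    _ = >-nonZero 0<Δ
  t′≡1+t : t′ ≡ suc t
  t′≡1+t = *-cancelʳ-≡ t′ (suc t) Δ (+-cancelˡ-≡ i (t′ * Δ) (suc t * Δ) (begin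
    i + t′ * Δ     ≡⟨ sym eq ⟩
    i + t * Δ + Δ  ≡⟨ solve (i ∷ t ∷ Δ ∷ []) ⟩
    i + suc t * Δ  ∎))
    where open ≡-Reasoning

module _ {A : Set} {f : A → A} {S : List A} {j Δ a : ℕ} where

  InPΔ⇒≤ : InPΔ f S j Δ a → a ≤ j
  InPΔ⇒≤ (_ , (_ , (_ , a≤j , _) , _ , _) , _) = a≤j

  InPΔ⇒Δ≤ : InPΔ f S j Δ a → Δ ≤ a
  InPΔ⇒Δ≤ (p , _ , refl) = m≤n+m Δ p

  InPΔ⇒0<Δ : InPΔ f S j Δ a → 0 < Δ
  InPΔ⇒0<Δ (p , (_ , _ , p<a , _) , refl) = +-cancelˡ-< p 0 Δ (subst (_< p + Δ) (sym (+-identityʳ p)) p<a)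

module Occurrences {A : Set} (f : A → A) (f-inv : IsInvolution f) (S : List A) where

  open Reflections (Maybe.map f) (maybe-map-involutive f-inv) (letter S)

  GenPal-sub⇔IsPal : ∀ a e → suc a + e ≤ length S →
                     GenPal f (sub S (suc a) (suc a + e)) ⇔ IsPal (suc a) (suc a + e)
  GenPal-sub⇔IsPal a e a+e<∣S∣ rewrite m+n∸m≡n a e = mk⇔
    (λ pal m n eq → Equivalence.to (letters (offsets eq))
                      (Equivalence.to mirrored pal m n (trans (cong suc (offsets eq)) (sym ∣window∣))))
    (λ pal → Equivalence.from mirrored λ m n eq →
      let m+n≡e = suc-injective (trans eq ∣window∣) in
      Equivalence.from (letters m+n≡e) (pal m n (trans (+-assoc (suc a) m n) (cong (suc a +_) m+n≡e))))
    where
    window : List A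
    window = take (e + 1) (drop a S)
    mirrored : GenPal f window ⇔ Mirrored f window
    mirrored = GenPal⇔mirrored f window
    ∣window∣ : length window ≡ suc e
    ∣window∣ = trans (length-take-drop a (e + 1) S
                       (subst (_≤ length S) (trans (sym (+-suc a e)) (cong (a +_) (+-comm 1 e))) a+e<∣S∣))
                     (+-comm e 1)
    at-window : ∀ {m} → m ≤ e → at window m ≡ letter S (suc a + m)
    at-window {m} m≤e = trans (at-take (e + 1) (drop a S) (subst (m <_) (+-comm 1 e) (s≤s m≤e))) (at-drop a S m)
    offsets : ∀ {m n} → suc a + m + n ≡ suc a + e → m + n ≡ e
    offsets {m} {n} eq = +-cancelˡ-≡ (suc a) (m + n) e (trans (sym (+-assoc (suc a) m n)) eq)
    letters : ∀ {m n} → m + n ≡ e →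
              (at window m ≡ Maybe.map f (at window n)) ⇔ (letter S (suc a + m) ≡ Maybe.map f (letter S (suc a + n)))
    letters {m} {n} refl = mk⇔ (subst₂ (λ u v → u ≡ Maybe.map f v) (at-window m≤) (at-window n≤))
                               (subst₂ (λ u v → u ≡ Maybe.map f v) (sym (at-window m≤)) (sym (at-window n≤)))
      where
      m≤ : m ≤ m + n
      m≤ = m≤m+n m n
      n≤ : n ≤ m + n
      n≤ = m≤n+m n m

  InP⇒IsPal : ∀ {j a} → j ≤ length S → InP f S j a → IsPal a j
  InP⇒IsPal j≤∣S∣ (s≤s z≤n , a≤j , pal) with m≤n⇒∃[o]m+o≡n a≤j
  ... | e , refl = Equivalence.to (GenPal-sub⇔IsPal _ e j≤∣S∣) pal

  IsPal⇒InP : ∀ {j a} → j ≤ length S → 1 ≤ a → a ≤ j → IsPal a j → InP f S j a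
  IsPal⇒InP j≤∣S∣ 1≤a@(s≤s z≤n) a≤j pal with m≤n⇒∃[o]m+o≡n a≤j
  ... | e , refl = 1≤a , a≤j , Equivalence.from (GenPal-sub⇔IsPal _ e j≤∣S∣) pal

  InP⇒periodic : ∀ {j p Δ} → j ≤ length S → InP f S j p → InP f S j (p + Δ) → Periodic Δ p j
  InP⇒periodic j≤∣S∣ p∈ p+Δ∈ = pals⇒periodic (InP⇒IsPal j≤∣S∣ p∈) (InP⇒IsPal j≤∣S∣ p+Δ∈)

  module _ {j Δ : ℕ} (j+Δ≤∣S∣ : j + Δ ≤ length S) where

    private
      j≤∣S∣ : j ≤ length S
      j≤∣S∣ = ≤-trans (m≤m+n j Δ) j+Δ≤∣S∣

    InP-shift : ∀ {c} → Periodic Δ c (j + Δ) → InP f S j c → InP f S (j + Δ) (c + Δ)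
    InP-shift per c∈@(1≤c , c≤j , _) =
      IsPal⇒InP j+Δ≤∣S∣ (≤-trans 1≤c (m≤m+n _ Δ)) (+-monoˡ-≤ Δ c≤j) (pal-shift (InP⇒IsPal j≤∣S∣ c∈) per)

    InP-unshift : ∀ {c} → Periodic Δ c (j + Δ) → 1 ≤ c → InP f S (j + Δ) (c + Δ) → InP f S j c
    InP-unshift {c} per 1≤c c+Δ∈@(_ , c+Δ≤j+Δ , _) =
      IsPal⇒InP j≤∣S∣ 1≤c (+-cancelʳ-≤ Δ c j c+Δ≤j+Δ) (pal-unshift (InP⇒IsPal j+Δ≤∣S∣ c+Δ∈) per)

    InP-dropʳ : ∀ {c} → Periodic Δ c (j + Δ) → c ≤ j → InP f S (j + Δ) c → InP f S j c
    InP-dropʳ per c≤j c∈@(1≤c , _ , _) =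
      IsPal⇒InP j≤∣S∣ 1≤c c≤j (pal-dropʳ (InP⇒IsPal j+Δ≤∣S∣ c∈) per)

    InP-extendʳ : ∀ {c} → Periodic Δ c (j + Δ) → c + Δ ≤ j → InP f S j c → InP f S (j + Δ) c
    InP-extendʳ per c+Δ≤j c∈@(1≤c , c≤j , _) =
      IsPal⇒InP j+Δ≤∣S∣ 1≤c (≤-trans c≤j (m≤m+n j Δ)) (pal-extendʳ (InP⇒IsPal j≤∣S∣ c∈) per c+Δ≤j)

    InPΔ-restrict : ∀ {a} → InPΔ f S (j + Δ) Δ a → InPΔ f S (j + Δ) Δ (a + Δ) → InPΔ f S j Δ a
    InPΔ-restrict (p , (p∈ , a∈ , p<a , _) , refl) (q , (_ , a+Δ∈ , _ , gap) , q+Δ≡a+Δ) =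
      p , (InP-dropʳ period (≤-trans (m≤m+n p Δ) a≤j) p∈ ,
           InP-dropʳ (periodic-mono period (m≤m+n p Δ)) a≤j a∈ , p<a , gap′) , refl
      where
      period : Periodic Δ p (j + Δ)
      period = InP⇒periodic j+Δ≤∣S∣ p∈ a∈
      a≤j : p + Δ ≤ j
      a≤j = +-cancelʳ-≤ Δ (p + Δ) j (proj₁ (proj₂ a+Δ∈))
      q≡a : q ≡ p + Δ
      q≡a = +-cancelʳ-≡ Δ q (p + Δ) q+Δ≡a+Δ
      gap′ : ∀ b → p < b → b < p + Δ → ¬ InP f S j b
      gap′ b p<b b<a b∈ = gap (b + Δ) (subst (_< b + Δ) (sym q≡a) (+-monoˡ-< Δ p<b)) (+-monoˡ-< Δ b<a)
                              (InP-shift (periodic-mono period (<⇒≤ p<b)) b∈)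

    -- The period Δ that S[p₀..j+Δ] inherits from p₀, p₀ + Δ ∈ P_{j+Δ} overlaps S[p..j] by at
    -- least Δ letters, so it extends the period of S[p..j] to all of S[p..j+Δ].
    InPΔ-extend : ∀ {i b} → InPΔ f S (j + Δ) Δ i → i ≤ j → InPΔ f S j Δ b →
                  InPΔ f S (j + Δ) Δ b × InPΔ f S (j + Δ) Δ (b + Δ)
    InPΔ-extend (p₀ , (p₀∈ , i∈ , _ , _) , refl) i≤j
                (p , (p∈@(1≤p , _ , _) , b∈@(_ , b≤j , _) , p<b , gap) , refl) =
      (p , (InP-extendʳ period b≤j p∈ , b∈′ , p<b , gap-below) , refl) ,
      (p + Δ , (b∈′ , InP-shift (periodic-mono period (m≤m+n p Δ)) b∈ , +-monoˡ-< Δ p<b , gap-above) , refl)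
      where
      period : Periodic Δ p (j + Δ)
      period = periodic-glue (InP⇒periodic j≤∣S∣ p∈ b∈) (InP⇒periodic j+Δ≤∣S∣ p₀∈ i∈) i≤j
      b∈′ : InP f S (j + Δ) (p + Δ)
      b∈′ = InP-shift period p∈
      gap-below : ∀ c → p < c → c < p + Δ → ¬ InP f S (j + Δ) c
      gap-below c p<c c<b c∈ =
        gap c p<c c<b (InP-dropʳ (periodic-mono period (<⇒≤ p<c)) (<⇒≤ (<-≤-trans c<b b≤j)) c∈)
      gap-above : ∀ c → p + Δ < c → c < p + Δ + Δ → ¬ InP f S (j + Δ) c
      gap-above c b<c c<b+Δ c∈ with m≤n⇒∃[o]m+o≡n (≤-trans (m≤n+m Δ p) (<⇒≤ b<c))
      ... | c′ , refl = gap c′ p<c′ c′<b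
                          (InP-unshift (periodic-mono period (<⇒≤ p<c′)) (≤-trans 1≤p (<⇒≤ p<c′))
                                       (subst (InP f S (j + Δ)) (+-comm Δ c′) c∈))
        where
        p<c′ : p < c′
        p<c′ = +-cancelʳ-< Δ p c′ (subst (p + Δ <_) (+-comm Δ c′) b<c)
        c′<b : c′ < p + Δ
        c′<b = +-cancelʳ-< Δ c′ (p + Δ) (subst (_< p + Δ + Δ) (+-comm Δ c′) c<b+Δ)

    progression-step : ∀ {i k} → InPΔ f S (j + Δ) Δ ≐ InProg i Δ (suc (suc k)) →
                       InPΔ f S j Δ ≐ InProg i Δ (suc k)
    progression-step {i} H a =
      (λ a∈ → let a∈′ , a+Δ∈′ = InPΔ-extend i∈ i≤j a∈ in
              InProg-prev (InPΔ⇒0<Δ i∈) (proj₁ (H a) a∈′) (proj₁ (H (a + Δ)) a+Δ∈′)) ,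
      (λ a∈ → InPΔ-restrict (proj₂ (H a) (InProg-weaken a∈)) (proj₂ (H (a + Δ)) (InProg-next a∈)))
      where
      i∈ : InPΔ f S (j + Δ) Δ i
      i∈ = proj₂ (H i) InProg-start
      i≤j : i ≤ j
      i≤j = +-cancelʳ-≤ Δ i j (InPΔ⇒≤ (proj₂ (H (i + Δ)) (InProg-next InProg-start)))

lemma6 : {A : Set} (f : A → A) → IsInvolution f →
    (S : List A) (j Δ k i : ℕ) →
    1 ≤ j → j ≤ length S → 2 ≤ k →
    InPΔ f S j Δ ≐ InProg i Δ k →
    InPΔ f S (j ∸ Δ) Δ ≐ InProg i Δ (k ∸ 1)
lemma6 f f-inv S j Δ (suc (suc k)) i _ j≤∣S∣ (s≤s (s≤s z≤n)) H =
  Occurrences.progression-step f f-inv S (subst (_≤ length S) (sym j∸Δ+Δ≡j) j≤∣S∣)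
    (subst (λ j′ → InPΔ f S j′ Δ ≐ InProg i Δ (suc (suc k))) (sym j∸Δ+Δ≡j) H)
  where
  i∈ : InPΔ f S j Δ i
  i∈ = proj₂ (H i) InProg-start
  j∸Δ+Δ≡j : j ∸ Δ + Δ ≡ j
  j∸Δ+Δ≡j = m∸n+n≡m (≤-trans (InPΔ⇒Δ≤ i∈) (InPΔ⇒≤ i∈))
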